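{- Let $\sigma$ be a weakly consecutive permutation of $[k]$. For every $m\in[k]$, the position $\sigma^{ -1}(m)$ satisfies $(k \bmod m) + 1 \le \sigma^{ -1}(m) \le k - (k \bmod m)$.
   Context: $[k]=\{1,\dots,k\}$. A permutation $\sigma:[k]\to[k]$ is weakly consecutive if for all $i,j\in[k]$ and all integers $m$, whenever $m\mid\sigma(i)$ and $m\mid(i-j)$, also $m\mid\sigma(j)$. $k\bmod m$ denotes the least nonnegative residue of $k$ modulo $m$. -}

module Defs where

open import Data.Nat using (ℕ; suc)
open import Data.Fin using (Fin; toℕ)
open import Data.Fin.Permutation using (Permutation′; _⟨$⟩ʳ_; _⟨$⟩ˡ_)
open import Data.Integer as ℤ using (ℤ; +_; _-_)
open import Data.Integer.Divisibility using (_∣_)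

-- [k] = {1,…,k} is represented by Fin k, with i : Fin k standing for toℕ i + 1.
pos : ∀ {k} → Fin k → ℕ
pos i = suc (toℕ i)

val : ∀ {k} → Permutation′ k → Fin k → ℕ
val σ i = pos (σ ⟨$⟩ʳ i)

WeaklyConsecutive : ∀ {k} → Permutation′ k → Set
WeaklyConsecutive {k} σ =
  ∀ (i j : Fin k) (m : ℤ) →
    m ∣ (+ val σ i) → m ∣ ((+ pos i) - (+ pos j)) → m ∣ (+ val σ j)

module Submission where

-- If m = σ(p), weak consecutivity makes σ map the whole residue class of p modulo m into
-- the multiples of m in [k], of which there are only ⌊k/m⌋. If p ≤ k mod m, the class contains
-- p, p + m, …, p + ⌊k/m⌋m ≤ k; if p > k − k mod m = ⌊k/m⌋m, it contains p, p − m, …, p − ⌊k/m⌋m ≥ 1.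
-- Either way that is ⌊k/m⌋ + 1 positions, contradicting injectivity of σ.

open import Defs
open import Data.Nat using (ℕ; _+_; _∸_; _≤_; _%_)
open import Data.Fin using (Fin; toℕ; fromℕ<)
open import Data.Fin.Permutation using (Permutation′; _⟨$⟩ˡ_; _⟨$⟩ʳ_; inverseʳ; inverseˡ)
open import Data.Product using (_×_; _,_)

open import Data.Nat as ℕ using (suc; pred; _*_; _<_; _≮_; _/_; NonZero; >-nonZero)
open import Data.Nat.Properties
open import Data.Nat.DivMod using (m≡m%n+[m/n]*n; /-monoˡ-≤; /-cancelʳ-≡; m≥n⇒m/n>0)
open import Data.Nat.Divisibility as ℕᵈ using (∣-refl; n∣m*n; ∣⇒≤)
open import Data.Fin.Properties using (toℕ-fromℕ<; toℕ<n; toℕ-injective; injective⇒≤)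
open import Data.Integer as ℤ using (+_; _-_; ∣_∣)
open import Data.Integer.Properties using ([+m]-[+n]≡m⊖n; ⊖-≥; ∣i-j∣≡∣j-i∣)
open import Data.Sum using (_⊎_; inj₁; inj₂)
open import Function using (_∘_; Injective)
open import Relation.Binary.PropositionalEquality

∣+[m+n]-+m∣≡n : ∀ m n → ∣ + (m + n) - + m ∣ ≡ n
∣+[m+n]-+m∣≡n m n = begin
  ∣ + (m + n) - + m ∣    ≡⟨ cong ∣_∣ ([+m]-[+n]≡m⊖n (m + n) m) ⟩
  ∣ (m + n) ℤ.⊖ m ∣      ≡⟨ cong ∣_∣ (⊖-≥ (m≤m+n m n)) ⟩
  m + n ∸ m              ≡⟨ m+n∸m≡n m n ⟩
  n                      ∎
  where open ≡-Reasoning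

∣+m-+[m+n]∣≡n : ∀ m n → ∣ + m - + (m + n) ∣ ≡ n
∣+m-+[m+n]∣≡n m n = trans (∣i-j∣≡∣j-i∣ (+ m) (+ (m + n))) (∣+[m+n]-+m∣≡n m n)

-- Index each value by its quotient by d, which lies in 1 … k / d.
injective-multiples≤ : ∀ {n} k d .{{_ : NonZero d}} (f : Fin n → ℕ) → Injective _≡_ _≡_ f →
  (∀ a → 0 < f a) → (∀ a → d ℕᵈ.∣ f a) → (∀ a → f a ≤ k) → n ≤ k / d
injective-multiples≤ k d f f-inj f>0 d∣f f≤k = injective⇒≤ {f = index} index-injective
  where
    suc-pred-quotient : ∀ a → suc (pred (f a / d)) ≡ f a / d
    suc-pred-quotient a = suc-pred (f a / d) {{>-nonZero (m≥n⇒m/n>0 (∣⇒≤ {{>-nonZero (f>0 a)}} (d∣f a)))}}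
    index : Fin _ → Fin (k / d)
    index a = fromℕ< (subst (_≤ k / d) (sym (suc-pred-quotient a)) (/-monoˡ-≤ d (f≤k a)))
    index-injective : Injective _≡_ _≡_ index
    index-injective {a} {b} eq = f-inj (/-cancelʳ-≡ (d∣f a) (d∣f b) (begin
      f a / d               ≡⟨ suc-pred-quotient a ⟨
      suc (pred (f a / d))  ≡⟨ cong suc (toℕ-fromℕ< _) ⟨
      suc (toℕ (index a))   ≡⟨ cong (suc ∘ toℕ) eq ⟩
      suc (toℕ (index b))   ≡⟨ cong suc (toℕ-fromℕ< _) ⟩
      suc (pred (f b / d))  ≡⟨ suc-pred-quotient b ⟩
      f b / d               ∎))
      where open ≡-Reasoning

module CongruentPositions {k} (σ : Permutation′ k) (wc : WeaklyConsecutive σ) (t : Fin k) where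

  p : Fin k
  p = σ ⟨$⟩ˡ t

  m : ℕ
  m = pos t

  ∣val-at-congruent : ∀ j c → pos j ≡ pos p + c * m ⊎ pos p ≡ pos j + c * m → m ℕᵈ.∣ val σ j
  ∣val-at-congruent j c congruent = wc p j (+ m) m∣val-p (m∣pos-difference congruent)
    where
      m∣val-p : m ℕᵈ.∣ val σ p
      m∣val-p = subst (λ i → m ℕᵈ.∣ pos i) (sym (inverseʳ σ)) ∣-refl
      m∣pos-difference : pos j ≡ pos p + c * m ⊎ pos p ≡ pos j + c * m →
                         m ℕᵈ.∣ ∣ + pos p - + pos j ∣
      m∣pos-difference (inj₁ eq) = subst (λ x → m ℕᵈ.∣ ∣ + pos p - + x ∣) (sym eq)
        (subst (m ℕᵈ.∣_) (sym (∣+m-+[m+n]∣≡n (pos p) (c * m))) (n∣m*n c))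
      m∣pos-difference (inj₂ eq) = subst (λ x → m ℕᵈ.∣ ∣ + x - + pos j ∣) (sym eq)
        (subst (m ℕᵈ.∣_) (sym (∣+[m+n]-+m∣≡n (pos j) (c * m))) (n∣m*n c))

  congruent-positions≤ : ∀ {n} (f : Fin n → ℕ) → Injective _≡_ _≡_ f → (f<k : ∀ a → f a < k) →
    (∀ a → f a ≡ toℕ p + toℕ a * m ⊎ toℕ p ≡ f a + toℕ a * m) → n ≤ k / m
  congruent-positions≤ f f-inj f<k congruent =
    injective-multiples≤ k m (val σ ∘ position) val-injective (λ _ → ℕ.s≤s ℕ.z≤n)
      (λ a → ∣val-at-congruent (position a) (toℕ a) (pos-congruent a)) (λ a → toℕ<n (σ ⟨$⟩ʳ position a))
    where
      position : Fin _ → Fin k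
      position a = fromℕ< (f<k a)
      pos-congruent : ∀ a → pos (position a) ≡ pos p + toℕ a * m ⊎ pos p ≡ pos (position a) + toℕ a * m
      pos-congruent a rewrite toℕ-fromℕ< (f<k a) with congruent a
      ... | inj₁ eq = inj₁ (cong suc eq)
      ... | inj₂ eq = inj₂ (cong suc eq)
      val-injective : Injective _≡_ _≡_ (val σ ∘ position)
      val-injective {a} {b} eq = f-inj (begin
        f a                          ≡⟨ toℕ-fromℕ< (f<k a) ⟨
        toℕ (position a)             ≡⟨ cong toℕ (σ-injective (toℕ-injective (suc-injective eq))) ⟩
        toℕ (position b)             ≡⟨ toℕ-fromℕ< (f<k b) ⟩
        f b                          ∎)
        where
          open ≡-Reasoning
          σ-injective : ∀ {i j} → σ ⟨$⟩ʳ i ≡ σ ⟨$⟩ʳ j → i ≡ j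
          σ-injective {i} {j} e = trans (sym (inverseˡ σ)) (trans (cong (σ ⟨$⟩ˡ_) e) (inverseˡ σ))

  a*m≤[k/m]*m : ∀ (a : Fin (suc (k / m))) → toℕ a * m ≤ (k / m) * m
  a*m≤[k/m]*m a = *-monoˡ-≤ m (ℕ.s≤s⁻¹ (toℕ<n a))

  k%m≤p : k % m ≤ toℕ p
  k%m≤p = ≮⇒≥ too-many-congruent
    where
      too-many-congruent : toℕ p ≮ k % m
      too-many-congruent p<k%m =
        1+n≰n (congruent-positions≤ ascending ascending-injective ascending<k (λ _ → inj₁ refl))
        where
          ascending : Fin (suc (k / m)) → ℕ
          ascending a = toℕ p + toℕ a * m
          ascending-injective : Injective _≡_ _≡_ ascending
          ascending-injective {a} {b} eq =
            toℕ-injective (*-cancelʳ-≡ (toℕ a) (toℕ b) m (+-cancelˡ-≡ (toℕ p) _ _ eq))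
          ascending<k : ∀ a → ascending a < k
          ascending<k a = subst (ascending a <_) (sym (m≡m%n+[m/n]*n k m)) (+-mono-<-≤ p<k%m (a*m≤[k/m]*m a))

  p≤[k/m]*m : pos p ≤ (k / m) * m
  p≤[k/m]*m = ≮⇒≥ too-many-congruent
    where
      too-many-congruent : (k / m) * m ≮ pos p
      too-many-congruent [k/m]*m<p =
        1+n≰n (congruent-positions≤ descending descending-injective descending<k
                 (λ a → inj₂ (sym (m∸n+n≡m (a*m≤p a)))))
        where
          a*m≤p : ∀ a → toℕ a * m ≤ toℕ p
          a*m≤p a = ℕ.s≤s⁻¹ (≤-<-trans (a*m≤[k/m]*m a) [k/m]*m<p)
          descending : Fin (suc (k / m)) → ℕ
          descending a = toℕ p ∸ toℕ a * m
          descending-injective : Injective _≡_ _≡_ descending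
          descending-injective {a} {b} eq = toℕ-injective (*-cancelʳ-≡ (toℕ a) (toℕ b) m (begin
            toℕ a * m                    ≡⟨ m∸[m∸n]≡n (a*m≤p a) ⟨
            toℕ p ∸ descending a         ≡⟨ cong (toℕ p ∸_) eq ⟩
            toℕ p ∸ descending b         ≡⟨ m∸[m∸n]≡n (a*m≤p b) ⟩
            toℕ b * m                    ∎))
            where open ≡-Reasoning
          descending<k : ∀ a → descending a < k
          descending<k a = ≤-<-trans (m∸n≤m (toℕ p) (toℕ a * m)) (toℕ<n p)

mainTheorem5 : ∀ (k : ℕ) (σ : Permutation′ k) → WeaklyConsecutive σ →
    ∀ (t : Fin k) →
      (k % pos t) + 1 ≤ pos (σ ⟨$⟩ˡ t) × pos (σ ⟨$⟩ˡ t) ≤ k ∸ (k % pos t)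
mainTheorem5 k σ wc t =
    subst (_≤ pos p) (+-comm 1 (k % m)) (ℕ.s≤s k%m≤p)
  , subst (pos p ≤_) [k/m]*m≡k∸k%m p≤[k/m]*m
  where
    open CongruentPositions σ wc t
    [k/m]*m≡k∸k%m : (k / m) * m ≡ k ∸ k % m
    [k/m]*m≡k∸k%m = sym (trans (cong (_∸ k % m) (m≡m%n+[m/n]*n k m)) (m+n∸m≡n (k % m) _))
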